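{- For every positive integer $d$ and every word $w$ (containing at least two distinct letters), $C_{d+1}(w)\geq 3C_d(w)$.
   Context: A word is a finite string $w=w_0\cdots w_{\ell-1}$ of letters; words are assumed to contain at least two distinct letters. A $d$-dimensional grid $\Gamma$ of shape $G=\prod_{i=1}^d\mathbb Z/n_i\mathbb Z$ is a map $\Gamma\colon G\to\Sigma$ to an alphabet; its size is $|G|$. An appearance of $w$ in $\Gamma$ is a pair $(p,\mathbf v)\in G\times(\{ -1,0,1\}^d\setminus\{\mathbf 0\})$ with $\Gamma(p+i\mathbf v)=w_i$ for $0\le i<\ell$. The concentration $c_d(w,\Gamma)$ is the number of appearances divided by $|G|$, and $C_d(w)$ is the supremum of $c_d(w,\Gamma)$ over all $d$-dimensional grids. -}

module Defs where

open import Data.Nat using (ℕ; zero; suc; _+_; _*_; NonZero)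
open import Data.Nat.DivMod using (_mod_)
open import Data.Fin using (Fin; zero; suc; toℕ)
open import Data.Vec using (Vec; []; _∷_)
open import Data.List using (List; []; _∷_; map; concatMap; allFin; length; lookup)
open import Data.Nat.ListAction using (sum)
open import Data.Bool using (Bool; true; false; _∧_; if_then_else_)
open import Data.Product using (_×_; _,_)
open import Data.Unit using (⊤; tt)
open import Data.Integer using (+_)
open import Data.Rational.Unnormalised using (ℚᵘ; _/_)
open import Relation.Nullary.Decidable using (⌊_⌋)
open import Relation.Binary.Definitions using (DecidableEquality)
open import Relation.Binary.PropositionalEquality using (_≢_)
open import Data.Product using (∃₂)

-- A shape of dimension d is given by a vector (m_1, ..., m_d); it encodes
-- G = ∏ ℤ/n_iℤ with n_i = m_i + 1 (so every factor is a nonempty finite cyclic group).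
Shape : ℕ → Set
Shape d = Vec ℕ d

Point : ∀ {d} → Shape d → Set
Point []       = ⊤
Point (m ∷ ms) = Fin (suc m) × Point ms

allPoints : ∀ {d} (ms : Shape d) → List (Point ms)
allPoints []       = tt ∷ []
allPoints (m ∷ ms) = concatMap (λ x → map (λ p → (x , p)) (allPoints ms)) (allFin (suc m))

size : ∀ {d} → Shape d → ℕ
size []       = 1
size (m ∷ ms) = suc m * size ms

size-nonzero : ∀ {d} (ms : Shape d) → NonZero (size ms)
size-nonzero []       = _
size-nonzero (m ∷ ms) with size ms | size-nonzero ms
... | suc k | _ = _

-- Direction vectors in {-1,0,1}^d; a coordinate in Fin 3 encodes
-- zero ↦ 0, suc zero ↦ +1, suc (suc zero) ↦ -1.
Dir : ℕ → Set
Dir d = Vec (Fin 3) d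

allDirs : ∀ d → List (Dir d)
allDirs zero    = [] ∷ []
allDirs (suc d) = concatMap (λ δ → map (δ ∷_) (allDirs d)) (allFin 3)

isZeroDir : ∀ {d} → Dir d → Bool
isZeroDir []          = true
isZeroDir (zero ∷ v)  = isZeroDir v
isZeroDir (suc _ ∷ v) = false

nonzeroDirs : ∀ d → List (Dir d)
nonzeroDirs d = Data.List.filterᵇ (λ v → if isZeroDir v then false else true) (allDirs d)

-- representative in {0,...,m} of δ modulo n = m+1
step : ℕ → Fin 3 → ℕ
step m zero             = 0
step m (suc zero)       = 1
step m (suc (suc zero)) = m

move : ∀ {d} {ms : Shape d} → Point ms → Dir d → ℕ → Point ms
move {ms = []}     tt       []      i = tt
move {ms = m ∷ ms} (x , p)  (δ ∷ v) i = ((toℕ x + i * step m δ) mod suc m) , move p v i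

Grid : ∀ {d} → Shape d → Set → Set
Grid ms A = Point ms → A

module _ {A : Set} (_≟_ : DecidableEquality A) where

  matchFrom : ∀ {d} {ms : Shape d} → Grid ms A → Point ms → Dir d → ℕ → List A → Bool
  matchFrom Γ p v k []       = true
  matchFrom Γ p v k (a ∷ as) = ⌊ Γ (move p v k) ≟ a ⌋ ∧ matchFrom Γ p v (suc k) as

  isAppearance : ∀ {d} {ms : Shape d} → List A → Grid ms A → Point ms → Dir d → Bool
  isAppearance w Γ p v = matchFrom Γ p v 0 w

  appearances : ∀ {d} (ms : Shape d) → List A → Grid ms A → ℕ
  appearances {d} ms w Γ =
    sum (concatMap (λ p → map (λ v → if isAppearance w Γ p v then 1 else 0) (nonzeroDirs d))
                   (allPoints ms))

  concentration : ∀ {d} (ms : Shape d) → List A → Grid ms A → ℚᵘ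
  concentration ms w Γ = _/_ (+ appearances ms w Γ) (size ms) {{size-nonzero ms}}

TwoLetters : {A : Set} → List A → Set
TwoLetters w = ∃₂ λ i j → lookup w i ≢ lookup w j

-- Stacking copies of Γ along a new axis, Γ′(x, p) = Γ(p), turns every appearance
-- (p, v) of w in Γ into the three appearances ((x, p), (δ, v)), δ ∈ {-1, 0, 1}, at
-- every height x, while |G| grows by the number of heights.
module Submission where

open import Defs
open import Data.Nat using (ℕ; suc)
open import Data.Product using (∃₂; _,_)
open import Data.List using (List)
open import Data.Integer using (+_)
open import Data.Rational.Unnormalised using (ℚᵘ; _≤_; _<_; _+_; _*_; 0ℚᵘ; _/_)
open import Relation.Binary.Definitions using (DecidableEquality)

open import Data.Bool using (Bool; true; false; T; if_then_else_; _∧_)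
open import Data.Fin using (Fin; zero; suc)
open import Data.List using ([]; _∷_; _++_; map; concatMap; filterᵇ; length; allFin)
open import Data.List.Properties using (map-∘; map-cong; map-concatMap; filter-++; length-tabulate)
open import Data.Nat.ListAction using (sum)
open import Data.Nat.ListAction.Properties using (sum-++)
open import Data.Vec using (_∷_; tail)
open import Function using (_∘_; id)
open import Relation.Binary.PropositionalEquality using (_≡_; refl; cong; sym; trans; subst₂; module ≡-Reasoning)
open import Relation.Nullary.Decidable using (T?)
import Data.Nat as ℕ
import Data.Nat.Properties as ℕ
import Data.Integer as ℤ
import Data.Integer.Properties as ℤ
import Data.Rational.Unnormalised as ℚ
import Data.Rational.Unnormalised.Properties as ℚ

module _ {A B : Set} where

  filterᵇ-map : (P : B → Bool) (g : A → B) (xs : List A) →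
                filterᵇ P (map g xs) ≡ map g (filterᵇ (P ∘ g) xs)
  filterᵇ-map P g []       = refl
  filterᵇ-map P g (x ∷ xs) with P (g x)
  ... | true  = cong (g x ∷_) (filterᵇ-map P g xs)
  ... | false = filterᵇ-map P g xs

  filterᵇ-concatMap : (P : B → Bool) (g : A → List B) (xs : List A) →
                      filterᵇ P (concatMap g xs) ≡ concatMap (filterᵇ P ∘ g) xs
  filterᵇ-concatMap P g []       = refl
  filterᵇ-concatMap P g (x ∷ xs) =
    trans (filter-++ (T? ∘ P) (g x) (concatMap g xs))
          (cong (filterᵇ P (g x) ++_) (filterᵇ-concatMap P g xs))

module _ {A : Set} where

  sum-concatMap : (g : A → List ℕ) (xs : List A) → sum (concatMap g xs) ≡ sum (map (sum ∘ g) xs)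
  sum-concatMap g []       = refl
  sum-concatMap g (x ∷ xs) =
    trans (sum-++ (g x) (concatMap g xs)) (cong (sum (g x) ℕ.+_) (sum-concatMap g xs))

  sum-map-concatMap : {B : Set} (f : B → ℕ) (g : A → List B) (xs : List A) →
                      sum (map f (concatMap g xs)) ≡ sum (map (sum ∘ map f ∘ g) xs)
  sum-map-concatMap f g xs = trans (cong sum (map-concatMap f g xs)) (sum-concatMap (map f ∘ g) xs)

  sum-map-filterᵇ-mono : (f : A → ℕ) {P Q : A → Bool} → (∀ x → T (P x) → T (Q x)) →
                         ∀ xs → sum (map f (filterᵇ P xs)) ℕ.≤ sum (map f (filterᵇ Q xs))
  sum-map-filterᵇ-mono f         P⇒Q []       = ℕ.z≤n
  sum-map-filterᵇ-mono f {P} {Q} P⇒Q (x ∷ xs) with P x | Q x | P⇒Q x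
  ... | true  | true  | _    = ℕ.+-monoʳ-≤ (f x) (sum-map-filterᵇ-mono f P⇒Q xs)
  ... | true  | false | P⇒Qx with () ← P⇒Qx _
  ... | false | true  | _    = ℕ.m≤n⇒m≤o+n (f x) (sum-map-filterᵇ-mono f P⇒Q xs)
  ... | false | false | _    = sum-map-filterᵇ-mono f P⇒Q xs

  length*≤sum-map : {c : ℕ} (g : A → ℕ) → (∀ x → c ℕ.≤ g x) → ∀ xs → length xs ℕ.* c ℕ.≤ sum (map g xs)
  length*≤sum-map g c≤g []       = ℕ.z≤n
  length*≤sum-map g c≤g (x ∷ xs) = ℕ.+-mono-≤ (c≤g x) (length*≤sum-map g c≤g xs)

  *-sum-map-mono : (k : ℕ) {f g : A → ℕ} → (∀ x → k ℕ.* f x ℕ.≤ g x) →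
                   ∀ xs → k ℕ.* sum (map f xs) ℕ.≤ sum (map g xs)
  *-sum-map-mono k         kf≤g []       = ℕ.≤-reflexive (ℕ.*-zeroʳ k)
  *-sum-map-mono k {f} {g} kf≤g (x ∷ xs) = begin
    k ℕ.* (f x ℕ.+ sum (map f xs))          ≡⟨ ℕ.*-distribˡ-+ k (f x) _ ⟩
    k ℕ.* f x ℕ.+ k ℕ.* sum (map f xs)       ≤⟨ ℕ.+-mono-≤ (kf≤g x) (*-sum-map-mono k kf≤g xs) ⟩
    g x ℕ.+ sum (map g xs)                  ∎
    where open ℕ.≤-Reasoning

isNonzeroDir : ∀ {d} → Dir d → Bool
isNonzeroDir v = if isZeroDir v then false else true

isNonzeroDir-∷ : ∀ {d} (δ : Fin 3) (v : Dir d) → T (isNonzeroDir v) → T (isNonzeroDir (δ ∷ v))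
isNonzeroDir-∷ zero    v nz = nz
isNonzeroDir-∷ (suc δ) v _  = _

sum-map-tail-nonzeroDirs : ∀ {d} (f : Dir d → ℕ) →
  3 ℕ.* sum (map f (nonzeroDirs d)) ℕ.≤ sum (map (f ∘ tail) (nonzeroDirs (suc d)))
sum-map-tail-nonzeroDirs {d} f = begin
  3 ℕ.* sum (map f (nonzeroDirs d))
    ≤⟨ length*≤sum-map layer layer-bound (allFin 3) ⟩
  sum (map layer (allFin 3))
    ≡⟨ sym (sum-map-concatMap (f ∘ tail) (λ δ → filterᵇ isNonzeroDir (map (δ ∷_) (allDirs d))) (allFin 3)) ⟩
  sum (map (f ∘ tail) (concatMap (λ δ → filterᵇ isNonzeroDir (map (δ ∷_) (allDirs d))) (allFin 3)))
    ≡⟨ cong (sum ∘ map (f ∘ tail)) (sym (filterᵇ-concatMap isNonzeroDir (λ δ → map (δ ∷_) (allDirs d)) (allFin 3))) ⟩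
  sum (map (f ∘ tail) (nonzeroDirs (suc d)))  ∎
  where
  open ℕ.≤-Reasoning
  layer : Fin 3 → ℕ
  layer δ = sum (map (f ∘ tail) (filterᵇ isNonzeroDir (map (δ ∷_) (allDirs d))))
  layer-bound : ∀ δ → sum (map f (nonzeroDirs d)) ℕ.≤ layer δ
  layer-bound δ = begin
    sum (map f (filterᵇ isNonzeroDir (allDirs d)))
      ≤⟨ sum-map-filterᵇ-mono f (isNonzeroDir-∷ δ) (allDirs d) ⟩
    sum (map f (filterᵇ (isNonzeroDir ∘ (δ ∷_)) (allDirs d)))
      ≡⟨ cong sum (map-∘ (filterᵇ (isNonzeroDir ∘ (δ ∷_)) (allDirs d))) ⟩
    sum (map (f ∘ tail) (map (δ ∷_) (filterᵇ (isNonzeroDir ∘ (δ ∷_)) (allDirs d))))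
      ≡⟨ cong (sum ∘ map (f ∘ tail)) (sym (filterᵇ-map isNonzeroDir (δ ∷_) (allDirs d))) ⟩
    layer δ  ∎

*-fraction-≤ : ∀ k a b n s .{{_ : ℕ.NonZero n}} .{{_ : ℕ.NonZero s}} → n ℕ.* (k ℕ.* a) ℕ.≤ b →
               (+ k / 1) * (+ a / s) ≤ _/_ (+ b) (n ℕ.* s) {{ℕ.m*n≢0 n s}}
-- ℚᵘ's _/_ only computes on a denominator of the form suc _, hence the patterns.
*-fraction-≤ k a b n@(suc _) s@(suc _) nka≤b = ℚ.*≤* (subst₂ ℤ._≤_ lhs rhs (ℤ.+≤+ (ℕ.*-monoˡ-≤ s nka≤b)))
  where
  open ≡-Reasoning
  lhs : + (n ℕ.* (k ℕ.* a) ℕ.* s) ≡ (+ k ℤ.* + a) ℤ.* + (n ℕ.* s)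
  lhs = begin
    + (n ℕ.* (k ℕ.* a) ℕ.* s)   ≡⟨ cong (λ m → + (m ℕ.* s)) (ℕ.*-comm n (k ℕ.* a)) ⟩
    + (k ℕ.* a ℕ.* n ℕ.* s)     ≡⟨ cong +_ (ℕ.*-assoc (k ℕ.* a) n s) ⟩
    + (k ℕ.* a ℕ.* (n ℕ.* s))   ≡⟨ ℤ.pos-* (k ℕ.* a) (n ℕ.* s) ⟩
    + (k ℕ.* a) ℤ.* + (n ℕ.* s) ≡⟨ cong (ℤ._* + (n ℕ.* s)) (ℤ.pos-* k a) ⟩
    (+ k ℤ.* + a) ℤ.* + (n ℕ.* s) ∎
  rhs : + (b ℕ.* s) ≡ + b ℤ.* + (1 ℕ.* s)
  rhs = trans (ℤ.pos-* b s) (cong (λ m → + b ℤ.* + m) (sym (ℕ.*-identityˡ s)))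

cylinder : ∀ {A d} {ms : Shape d} (m : ℕ) → Grid ms A → Grid (m ∷ ms) A
cylinder m Γ (_ , p) = Γ p

module _ {A : Set} (_≟_ : DecidableEquality A) where

  matchFrom-cylinder : ∀ {d} {ms : Shape d} (m : ℕ) (Γ : Grid ms A) x p δ v k (u : List A) →
                       matchFrom _≟_ (cylinder m Γ) (x , p) (δ ∷ v) k u ≡ matchFrom _≟_ Γ p v k u
  matchFrom-cylinder m Γ x p δ v k []      = refl
  matchFrom-cylinder m Γ x p δ v k (a ∷ u) = cong (_ ∧_) (matchFrom-cylinder m Γ x p δ v (suc k) u)

module _ {A : Set} (_≟_ : DecidableEquality A) (w : List A) where

  appearancesAt : ∀ {d} {ms : Shape d} → Grid ms A → Point ms → ℕ
  appearancesAt {d} Γ p = sum (map (λ v → if isAppearance _≟_ w Γ p v then 1 else 0) (nonzeroDirs d))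

  appearances≡sum-appearancesAt : ∀ {d} (ms : Shape d) (Γ : Grid ms A) →
                                  appearances _≟_ ms w Γ ≡ sum (map (appearancesAt Γ) (allPoints ms))
  appearances≡sum-appearancesAt ms Γ = sum-concatMap _ (allPoints ms)

  appearancesAt-cylinder : ∀ {d} {ms : Shape d} (m : ℕ) (Γ : Grid ms A) x p →
                           3 ℕ.* appearancesAt Γ p ℕ.≤ appearancesAt (cylinder m Γ) (x , p)
  appearancesAt-cylinder {d} m Γ x p = begin
    3 ℕ.* appearancesAt Γ p                                 ≤⟨ sum-map-tail-nonzeroDirs indicator ⟩
    sum (map (indicator ∘ tail) (nonzeroDirs (suc d)))      ≡⟨ cong sum (map-cong lift (nonzeroDirs (suc d))) ⟩
    appearancesAt (cylinder m Γ) (x , p)                    ∎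
    where
    open ℕ.≤-Reasoning
    indicator : Dir d → ℕ
    indicator v = if isAppearance _≟_ w Γ p v then 1 else 0
    lift : ∀ u → indicator (tail u) ≡ (if isAppearance _≟_ w (cylinder m Γ) (x , p) u then 1 else 0)
    lift (δ ∷ v) = cong (λ b → if b then 1 else 0) (sym (matchFrom-cylinder _≟_ m Γ x p δ v 0 w))

  appearances-cylinder : ∀ {d} (ms : Shape d) (m : ℕ) (Γ : Grid ms A) →
                         suc m ℕ.* (3 ℕ.* appearances _≟_ ms w Γ) ℕ.≤ appearances _≟_ (m ∷ ms) w (cylinder m Γ)
  appearances-cylinder ms m Γ = begin
    suc m ℕ.* (3 ℕ.* appearances _≟_ ms w Γ)
      ≡⟨ cong (λ n → n ℕ.* (3 ℕ.* appearances _≟_ ms w Γ)) (sym (length-tabulate {n = suc m} id)) ⟩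
    length (allFin (suc m)) ℕ.* (3 ℕ.* appearances _≟_ ms w Γ)
      ≤⟨ length*≤sum-map height height-bound (allFin (suc m)) ⟩
    sum (map height (allFin (suc m)))
      ≡⟨ sym (sum-map-concatMap (appearancesAt Γ′) (λ x → map (x ,_) (allPoints ms)) (allFin (suc m))) ⟩
    sum (map (appearancesAt Γ′) (allPoints (m ∷ ms)))
      ≡⟨ sym (appearances≡sum-appearancesAt (m ∷ ms) Γ′) ⟩
    appearances _≟_ (m ∷ ms) w Γ′  ∎
    where
    open ℕ.≤-Reasoning
    Γ′ : Grid (m ∷ ms) A
    Γ′ = cylinder m Γ
    height : Fin (suc m) → ℕ
    height x = sum (map (appearancesAt Γ′) (map (x ,_) (allPoints ms)))
    height-bound : ∀ x → 3 ℕ.* appearances _≟_ ms w Γ ℕ.≤ height x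
    height-bound x = begin
      3 ℕ.* appearances _≟_ ms w Γ                          ≡⟨ cong (3 ℕ.*_) (appearances≡sum-appearancesAt ms Γ) ⟩
      3 ℕ.* sum (map (appearancesAt Γ) (allPoints ms))      ≤⟨ *-sum-map-mono 3 (appearancesAt-cylinder m Γ x) (allPoints ms) ⟩
      sum (map (appearancesAt Γ′ ∘ (x ,_)) (allPoints ms))  ≡⟨ cong sum (map-∘ (allPoints ms)) ⟩
      height x                                              ∎

  concentration-cylinder : ∀ {d} (ms : Shape d) (m : ℕ) (Γ : Grid ms A) →
    (+ 3 / 1) * concentration _≟_ ms w Γ ≤ concentration _≟_ (m ∷ ms) w (cylinder m Γ)
  concentration-cylinder ms m Γ =
    *-fraction-≤ 3 _ _ (suc m) (size ms) {{_}} {{size-nonzero ms}} (appearances-cylinder ms m Γ)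

lemma2p2 : (d : ℕ) → {A : Set} → (_≟_ : DecidableEquality A) → (w : List A) → TwoLetters w →
           (ms : Shape (suc d)) → (Γ : Grid ms A) → (ε : ℚᵘ) → 0ℚᵘ < ε →
           ∃₂ λ (ms′ : Shape (suc (suc d))) (Γ′ : Grid ms′ A) →
             ((+ 3) / 1) * concentration _≟_ ms w Γ ≤ concentration _≟_ ms′ w Γ′ + ε
lemma2p2 d _≟_ w _ ms Γ ε 0<ε =
  0 ∷ ms , cylinder 0 Γ ,
  ℚ.≤-trans (concentration-cylinder _≟_ w ms 0 Γ)
            (ℚ.p≤p+q _ ε {{ℚ.pos⇒nonNeg ε {{ℚ.positive 0<ε}}}})
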